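{- Let $w$ be a uniformly random binary word of length $n$, let $w'=\mathrm{PNF}(w)$, and let $Z$ be the critical prefix length of $w'$. Then $E(Z)=\Theta(\log n)$.
   Context: For a binary word $x$ and $0\le k\le|x|$, let $P(x,k)$ be the number of $1$s in the length-$k$ prefix of $x$. Let $F(x,k)$ be the maximum number of $1$s over length-$k$ substrings of $x$. A word $x$ is prefix normal if $F(x,k)=P(x,k)$ for all $1\le k\le|x|$. For every binary word $w$ there is a unique prefix normal word $\mathrm{PNF}(w)$ of the same length such that $F(w,k)=F(\mathrm{PNF}(w),k)$ for all $k$; it is called the prefix normal form of $w$. Every word $x\neq1^n$ can be written uniquely as $x=1^s0^t\gamma$ with $s\ge0$, $t\ge1$, and $\gamma$ empty or beginning with $1$. Its critical prefix length is $s+t$. For $x=1^n$ the critical prefix length is taken to be $n$. -}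

module Defs where

open import Data.Bool using (Bool; true; false)
open import Data.Nat using (ℕ; zero; suc; _+_; _∸_; _⊔_; _≤_)
open import Data.List using (List; []; _∷_; length; take; drop; map; foldr; upTo; concatMap)
open import Relation.Binary.PropositionalEquality using (_≡_)
open import Data.Product using (_×_)
open import Data.Nat.ListAction using (sum)

Word : Set
Word = List Bool

ones : Word → ℕ
ones []          = 0
ones (true ∷ x)  = suc (ones x)
ones (false ∷ x) = ones x

P : Word → ℕ → ℕ
P x k = ones (take k x)

-- F(x,k): maximum number of 1s over the length-k substrings x[i..i+k-1],
-- i = 0 .. |x|-k  (meaningful for k ≤ |x|)
F : Word → ℕ → ℕ
F x k = foldr _⊔_ 0 (map (λ i → ones (take k (drop i x))) (upTo (suc (length x ∸ k))))

PrefixNormal : Word → Set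
PrefixNormal x = ∀ k → 1 ≤ k → k ≤ length x → F x k ≡ P x k

IsPNFOf : Word → Word → Set
IsPNFOf w v = (length v ≡ length w) × PrefixNormal v × (∀ k → k ≤ length w → F w k ≡ F v k)

IsPNF : (Word → Word) → Set
IsPNF pnf = ∀ w → IsPNFOf w (pnf w)

leadOnes : Word → ℕ
leadOnes (true ∷ x) = suc (leadOnes x)
leadOnes _          = 0

leadZeros : Word → ℕ
leadZeros (false ∷ x) = suc (leadZeros x)
leadZeros _           = 0

-- critical prefix length: x = 1^s 0^t γ gives s + t; for x = 1^n this is n + 0 = n
crit : Word → ℕ
crit x = leadOnes x + leadZeros (drop (leadOnes x) x)

allWords : ℕ → List Word
allWords zero    = [] ∷ []
allWords (suc n) = concatMap (λ w → (false ∷ w) ∷ (true ∷ w) ∷ []) (allWords n)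

-- 2^n · E(Z) : sum of the critical prefix length of PNF(w) over all words w of length n
totalZ : (Word → Word) → ℕ → ℕ
totalZ pnf n = sum (map (λ w → crit (pnf w)) (allWords n))

-- Write Z(w) for the critical prefix length of PNF(w). Its leading block of ones is as long as the
-- longest run of ones in w, so Z(w) ≥ m as soon as w contains 1^m. Conversely, if w contains no 1^j
-- then PNF(w) starts with fewer than j ones, and if moreover some factor of w of length k carries at
-- least j ones then so does the length-k prefix of PNF(w), which therefore leaves 1^s 0^t: Z(w) < k.
--
-- Let L = ⌊log₂ n⌋. Cutting w into 2^m blocks of length m = ⌊L/2⌋, the probability that no block is
-- 1^m is (1 − 2^-m)^(2^m) ≤ 1/2, so E(Z) ≥ m/2. For j = 2(L+1) and k = 2j the probability that w
-- contains 1^j is at most (n+1)/2^j ≤ 1/n, and the probability that each of L disjoint blocks of length k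
-- carries fewer than j ones is at most 2^-L ≤ 2/n, by complementation within each block. Outside these
-- events Z < k, and always Z ≤ n, so E(Z) ≤ k + 3.

module Submission where

open import Data.Bool using (true; false; not)
open import Data.Empty using (⊥-elim)
open import Data.List using ([]; _∷_; length; take; drop; map; foldr; concatMap; applyUpTo; _++_)
open import Data.List.Properties using (map-applyUpTo; length-++)
open import Data.Nat
open import Data.Nat.ListAction using (sum)
open import Data.Nat.Logarithm using (⌊log₂_⌋; ⌊log₂⌋-mono-≤; ⌊log₂[2^n]⌋≡n)
open import Data.Nat.Logarithm.Core using (⌊log2⌋)
open import Data.Nat.Properties
open import Data.Nat.Tactic.RingSolver using (solve-∀)
open import Data.Product using (∃; _×_; _,_; proj₁)
open import Data.Sum using (inj₁; inj₂)
open import Function using (_∘_)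
open import Induction.WellFounded using (Acc; acc)
open import Relation.Binary.PropositionalEquality
open import Relation.Nullary using (yes; no)

open import Defs

-- Sums over all words of a given length

sumWords : ℕ → (Word → ℕ) → ℕ
sumWords zero    f = f []
sumWords (suc n) f = sumWords n (λ w → f (false ∷ w) + f (true ∷ w))

sum-map-concatMap-cons : ∀ (f : Word → ℕ) ws →
  sum (map f (concatMap (λ w → (false ∷ w) ∷ (true ∷ w) ∷ []) ws)) ≡
  sum (map (λ w → f (false ∷ w) + f (true ∷ w)) ws)
sum-map-concatMap-cons f []       = refl
sum-map-concatMap-cons f (w ∷ ws) = trans (sym (+-assoc (f (false ∷ w)) _ _))
  (cong (f (false ∷ w) + f (true ∷ w) +_) (sum-map-concatMap-cons f ws))

sum-map-allWords : ∀ n f → sum (map f (allWords n)) ≡ sumWords n f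
sum-map-allWords zero    f = +-identityʳ (f [])
sum-map-allWords (suc n) f = trans (sum-map-concatMap-cons f (allWords n)) (sum-map-allWords n _)

sumWords-cong : ∀ n {f g : Word → ℕ} → (∀ w → f w ≡ g w) → sumWords n f ≡ sumWords n g
sumWords-cong zero    f≗g = f≗g []
sumWords-cong (suc n) f≗g = sumWords-cong n (λ w → cong₂ _+_ (f≗g (false ∷ w)) (f≗g (true ∷ w)))

sumWords-mono : ∀ n {f g : Word → ℕ} → (∀ w → length w ≡ n → f w ≤ g w) → sumWords n f ≤ sumWords n g
sumWords-mono zero    f≤g = f≤g [] refl
sumWords-mono (suc n) f≤g = sumWords-mono n (λ w |w| →
  +-mono-≤ (f≤g (false ∷ w) (cong suc |w|)) (f≤g (true ∷ w) (cong suc |w|)))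

sumWords-+ : ∀ n f g → sumWords n (λ w → f w + g w) ≡ sumWords n f + sumWords n g
sumWords-+ zero    f g = refl
sumWords-+ (suc n) f g =
  trans (sumWords-cong n (λ w → interchange (f (false ∷ w)) _ _ _)) (sumWords-+ n _ _)
  where
  interchange : ∀ a b c d → (a + b) + (c + d) ≡ (a + c) + (b + d)
  interchange = solve-∀

sumWords-*ˡ : ∀ n c f → sumWords n (λ w → c * f w) ≡ c * sumWords n f
sumWords-*ˡ zero    c f = refl
sumWords-*ˡ (suc n) c f =
  trans (sumWords-cong n (λ w → sym (*-distribˡ-+ c (f (false ∷ w)) _))) (sumWords-*ˡ n c _)

sumWords-*ʳ : ∀ n f c → sumWords n (λ w → f w * c) ≡ sumWords n f * c
sumWords-*ʳ zero    f c = refl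
sumWords-*ʳ (suc n) f c =
  trans (sumWords-cong n (λ w → sym (*-distribʳ-+ c (f (false ∷ w)) _))) (sumWords-*ʳ n _ c)

sumWords-const : ∀ n c → sumWords n (λ _ → c) ≡ c * 2 ^ n
sumWords-const zero    c = sym (*-identityʳ c)
sumWords-const (suc n) c = trans (sumWords-const n (c + c)) (doubling c (2 ^ n))
  where
  doubling : ∀ c x → (c + c) * x ≡ c * (2 * x)
  doubling = solve-∀

sumWords-≤ : ∀ n {f c} → (∀ w → length w ≡ n → f w ≤ c) → sumWords n f ≤ c * 2 ^ n
sumWords-≤ n {c = c} f≤c = ≤-trans (sumWords-mono n f≤c) (≤-reflexive (sumWords-const n c))

sumWords-complement : ∀ n {f} → (∀ w → f w ≤ 1) →
                      sumWords n (λ w → 1 ∸ f w) + sumWords n f ≡ 2 ^ n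
sumWords-complement n {f} f≤1 = begin
  sumWords n (λ w → 1 ∸ f w) + sumWords n f  ≡⟨ sumWords-+ n _ f ⟨
  sumWords n (λ w → 1 ∸ f w + f w)           ≡⟨ sumWords-cong n (λ w → m∸n+n≡m (f≤1 w)) ⟩
  sumWords n (λ _ → 1)                       ≡⟨ sumWords-const n 1 ⟩
  1 * 2 ^ n                                  ≡⟨ *-identityˡ _ ⟩
  2 ^ n                                      ∎
  where open ≡-Reasoning

sumWords-++ : ∀ m k f → sumWords (m + k) f ≡ sumWords m (λ u → sumWords k (λ v → f (u ++ v)))
sumWords-++ zero    k f = refl
sumWords-++ (suc m) k f = trans (sumWords-++ m k _) (sumWords-cong m (λ u → sumWords-+ k _ _))

sumWords-++-≤ : ∀ m k {f g h} → (∀ u v → length u ≡ m → length v ≡ k → f (u ++ v) ≤ g u * h v) →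
                sumWords (m + k) f ≤ sumWords m g * sumWords k h
sumWords-++-≤ m k {f} {g} {h} f≤g*h = begin
  sumWords (m + k) f                                ≡⟨ sumWords-++ m k f ⟩
  sumWords m (λ u → sumWords k (λ v → f (u ++ v)))  ≤⟨ sumWords-mono m (λ u |u| →
                                                         sumWords-mono k (λ v |v| → f≤g*h u v |u| |v|)) ⟩
  sumWords m (λ u → sumWords k (λ v → g u * h v))   ≡⟨ sumWords-cong m (λ u → sumWords-*ˡ k (g u) h) ⟩
  sumWords m (λ u → g u * sumWords k h)             ≡⟨ sumWords-*ʳ m g _ ⟩
  sumWords m g * sumWords k h                       ∎
  where open ≤-Reasoning

sumWords-map-not : ∀ n f → sumWords n (f ∘ map not) ≡ sumWords n f
sumWords-map-not zero    f = refl
sumWords-map-not (suc n) f =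
  trans (sumWords-cong n (λ w → +-comm (f (true ∷ map not w)) _)) (sumWords-map-not n _)

-- Windows, prefixes and the critical prefix

window : Word → ℕ → ℕ → ℕ
window w k i = ones (take k (drop i w))

≤-foldr-⊔-applyUpTo : ∀ (h : ℕ → ℕ) m {i} → i < m → h i ≤ foldr _⊔_ 0 (applyUpTo h m)
≤-foldr-⊔-applyUpTo h (suc m) {zero}  _         = m≤m⊔n _ _
≤-foldr-⊔-applyUpTo h (suc m) {suc i} (s≤s i<m) =
  ≤-trans (≤-foldr-⊔-applyUpTo (h ∘ suc) m i<m) (m≤n⊔m (h 0) _)

foldr-⊔-applyUpTo-lub : ∀ (h : ℕ → ℕ) m {b} → (∀ i → i < m → h i ≤ b) →
                        foldr _⊔_ 0 (applyUpTo h m) ≤ b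
foldr-⊔-applyUpTo-lub h zero    h≤b = z≤n
foldr-⊔-applyUpTo-lub h (suc m) h≤b =
  ⊔-lub (h≤b 0 z<s) (foldr-⊔-applyUpTo-lub (h ∘ suc) m (λ i i<m → h≤b (suc i) (s<s i<m)))

F≡max-window : ∀ w k → F w k ≡ foldr _⊔_ 0 (applyUpTo (window w k) (suc (length w ∸ k)))
F≡max-window w k = cong (foldr _⊔_ 0) (map-applyUpTo (λ i → i) (window w k) (suc (length w ∸ k)))

window≤F : ∀ w k {i} → i ≤ length w ∸ k → window w k i ≤ F w k
window≤F w k {i} i≤ =
  subst (window w k i ≤_) (sym (F≡max-window w k)) (≤-foldr-⊔-applyUpTo (window w k) _ (s≤s i≤))

F-lub : ∀ w k {b} → (∀ i → i ≤ length w ∸ k → window w k i ≤ b) → F w k ≤ b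
F-lub w k {b} window≤b = subst (_≤ b) (sym (F≡max-window w k))
  (foldr-⊔-applyUpTo-lub (window w k) _ (λ i i< → window≤b i (≤-pred i<)))

ones-take≤ : ∀ m x → P x m ≤ m
ones-take≤ zero    x           = z≤n
ones-take≤ (suc m) []          = z≤n
ones-take≤ (suc m) (true ∷ x)  = s≤s (ones-take≤ m x)
ones-take≤ (suc m) (false ∷ x) = m≤n⇒m≤1+n (ones-take≤ m x)

ones+ones-map-not : ∀ u → ones u + ones (map not u) ≡ length u
ones+ones-map-not []          = refl
ones+ones-map-not (true ∷ u)  = cong suc (ones+ones-map-not u)
ones+ones-map-not (false ∷ u) = trans (+-suc (ones u) _) (cong suc (ones+ones-map-not u))

P-leadOnes : ∀ m v → m ≤ leadOnes v → P v m ≡ m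
P-leadOnes zero    v          _        = refl
P-leadOnes (suc m) (true ∷ v) (s≤s m≤) = cong suc (P-leadOnes m v m≤)

≤P⇒≤leadOnes : ∀ m v → m ≤ P v m → m ≤ leadOnes v
≤P⇒≤leadOnes zero    v           _        = z≤n
≤P⇒≤leadOnes (suc m) (true ∷ v)  (s≤s m≤) = s≤s (≤P⇒≤leadOnes m v m≤)
≤P⇒≤leadOnes (suc m) (false ∷ v) m<       = ⊥-elim (<⇒≱ (s≤s (ones-take≤ m v)) m<)

P-leadZeros : ∀ k x → k ≤ leadZeros x → P x k ≡ 0
P-leadZeros zero    x           _        = refl
P-leadZeros (suc k) (false ∷ x) (s≤s k≤) = P-leadZeros k x k≤

P≤leadOnes : ∀ k v → k ≤ crit v → P v k ≤ leadOnes v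
P≤leadOnes zero    v           _        = z≤n
P≤leadOnes (suc k) []          _        = z≤n
P≤leadOnes (suc k) (true ∷ v)  (s≤s k≤) = s≤s (P≤leadOnes k v k≤)
P≤leadOnes (suc k) (false ∷ v) k≤       = ≤-reflexive (P-leadZeros (suc k) (false ∷ v) k≤)

leadZeros≤length : ∀ x → leadZeros x ≤ length x
leadZeros≤length []          = z≤n
leadZeros≤length (true ∷ x)  = z≤n
leadZeros≤length (false ∷ x) = s≤s (leadZeros≤length x)

crit≤length : ∀ v → crit v ≤ length v
crit≤length []          = z≤n
crit≤length (true ∷ v)  = s≤s (crit≤length v)
crit≤length (false ∷ v) = s≤s (leadZeros≤length v)

-- Runs of ones

-- Events are encoded by 0/1-valued indicators, so that sumWords counts words.
startsWithOnes : ℕ → Word → ℕ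
startsWithOnes zero    _          = 1
startsWithOnes (suc m) (true ∷ w) = startsWithOnes m w
startsWithOnes (suc m) _          = 0

hasOnesRun : ℕ → Word → ℕ
hasOnesRun m []      = startsWithOnes m []
hasOnesRun m (b ∷ w) = startsWithOnes m (b ∷ w) ⊔ hasOnesRun m w

𝟙[_<_] : ℕ → ℕ → ℕ
𝟙[ _     < zero  ] = 0
𝟙[ zero  < suc _ ] = 1
𝟙[ suc x < suc j ] = 𝟙[ x < j ]

startsWithOnes≤1 : ∀ m w → startsWithOnes m w ≤ 1
startsWithOnes≤1 zero    w           = s≤s z≤n
startsWithOnes≤1 (suc m) []          = z≤n
startsWithOnes≤1 (suc m) (true ∷ w)  = startsWithOnes≤1 m w
startsWithOnes≤1 (suc m) (false ∷ w) = z≤n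

hasOnesRun≤1 : ∀ m w → hasOnesRun m w ≤ 1
hasOnesRun≤1 m []      = startsWithOnes≤1 m []
hasOnesRun≤1 m (b ∷ w) = ⊔-lub (startsWithOnes≤1 m (b ∷ w)) (hasOnesRun≤1 m w)

𝟙<≤1 : ∀ x j → 𝟙[ x < j ] ≤ 1
𝟙<≤1 x       zero    = z≤n
𝟙<≤1 zero    (suc j) = s≤s z≤n
𝟙<≤1 (suc x) (suc j) = 𝟙<≤1 x j

𝟙<-antitone : ∀ {x y} j → x ≤ y → 𝟙[ y < j ] ≤ 𝟙[ x < j ]
𝟙<-antitone                 zero    _         = z≤n
𝟙<-antitone {zero}  {zero}  (suc j) _         = ≤-refl
𝟙<-antitone {zero}  {suc y} (suc j) _         = 𝟙<≤1 y j
𝟙<-antitone {suc x} {suc y} (suc j) (s≤s x≤y) = 𝟙<-antitone j x≤y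

𝟙<≡0⇒≥ : ∀ x j → 𝟙[ x < j ] ≡ 0 → j ≤ x
𝟙<≡0⇒≥ x       zero    _  = z≤n
𝟙<≡0⇒≥ (suc x) (suc j) eq = s≤s (𝟙<≡0⇒≥ x j eq)

𝟙<-≥ : ∀ {x j} → j ≤ x → 𝟙[ x < j ] ≡ 0
𝟙<-≥ {x}     {zero}  _         = refl
𝟙<-≥ {suc x} {suc j} (s≤s j≤x) = 𝟙<-≥ j≤x

𝟙<+𝟙<≤1 : ∀ a b j → a + b ≡ j + j → 𝟙[ a < j ] + 𝟙[ b < j ] ≤ 1
𝟙<+𝟙<≤1 a b j a+b≡j+j with a <? j | b <? j
... | no a≮j  | _       rewrite 𝟙<-≥ {a} {j} (≮⇒≥ a≮j) = 𝟙<≤1 b j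
... | yes _   | no b≮j  rewrite 𝟙<-≥ {b} {j} (≮⇒≥ b≮j) =
  ≤-trans (≤-reflexive (+-identityʳ _)) (𝟙<≤1 a j)
... | yes a<j | yes b<j = ⊥-elim (<-irrefl a+b≡j+j (+-mono-< a<j b<j))

≤1⇒≤* : ∀ {x a b} → x ≤ 1 → x ≤ a → x ≤ b → x ≤ a * b
≤1⇒≤* {zero}        _        _   _   = z≤n
≤1⇒≤* {suc zero}    _        x≤a x≤b = *-mono-≤ x≤a x≤b
≤1⇒≤* {suc (suc _)} (s≤s ()) _   _

startsWithOnes≡1⇒P≡ : ∀ m x → startsWithOnes m x ≡ 1 → m ≤ length x × P x m ≡ m
startsWithOnes≡1⇒P≡ zero    x          _  = z≤n , refl
startsWithOnes≡1⇒P≡ (suc m) (true ∷ x) eq with startsWithOnes≡1⇒P≡ m x eq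
... | m≤|x| , Pm≡m = s≤s m≤|x| , cong suc Pm≡m

startsWithOnes≡0⇒P< : ∀ m x → startsWithOnes m x ≡ 0 → P x m < m
startsWithOnes≡0⇒P< (suc m) []          _  = z<s
startsWithOnes≡0⇒P< (suc m) (true ∷ x)  eq = s<s (startsWithOnes≡0⇒P< m x eq)
startsWithOnes≡0⇒P< (suc m) (false ∷ x) _  = s≤s (ones-take≤ m x)

startsWithOnes-++ : ∀ m u v → startsWithOnes m u ≤ startsWithOnes m (u ++ v)
startsWithOnes-++ zero    u           v = ≤-refl
startsWithOnes-++ (suc m) []          v = z≤n
startsWithOnes-++ (suc m) (true ∷ u)  v = startsWithOnes-++ m u v
startsWithOnes-++ (suc m) (false ∷ u) v = z≤n

startsWithOnes≤hasOnesRun : ∀ m w → startsWithOnes m w ≤ hasOnesRun m w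
startsWithOnes≤hasOnesRun m []      = ≤-refl
startsWithOnes≤hasOnesRun m (b ∷ w) = m≤m⊔n _ _

startsWithOnes-drop≤hasOnesRun : ∀ m w i → startsWithOnes m (drop i w) ≤ hasOnesRun m w
startsWithOnes-drop≤hasOnesRun m w       zero    = startsWithOnes≤hasOnesRun m w
startsWithOnes-drop≤hasOnesRun m []      (suc i) = ≤-refl
startsWithOnes-drop≤hasOnesRun m (b ∷ w) (suc i) =
  ≤-trans (startsWithOnes-drop≤hasOnesRun m w i) (m≤n⊔m _ _)

hasOnesRun-++ : ∀ m u v → hasOnesRun m v ≤ hasOnesRun m (u ++ v)
hasOnesRun-++ m []      v = ≤-refl
hasOnesRun-++ m (b ∷ u) v = ≤-trans (hasOnesRun-++ m u v) (m≤n⊔m _ _)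

hasOnesRun-∷ : ∀ m b w → hasOnesRun m (b ∷ w) ≤ startsWithOnes m (b ∷ w) + hasOnesRun m w
hasOnesRun-∷ m b w = m⊔n≤m+n (startsWithOnes m (b ∷ w)) (hasOnesRun m w)

hasOnesRun≡1⇒window : ∀ m w → hasOnesRun m w ≡ 1 → ∃ λ i → i + m ≤ length w × window w m i ≡ m
hasOnesRun≡1⇒window m []      eq = 0 , startsWithOnes≡1⇒P≡ m [] eq
hasOnesRun≡1⇒window m (b ∷ w) eq with n≤1⇒n≡0∨n≡1 (startsWithOnes≤1 m (b ∷ w))
... | inj₂ here    = 0 , startsWithOnes≡1⇒P≡ m (b ∷ w) here
... | inj₁ notHere with hasOnesRun≡1⇒window m w (trans (cong (_⊔ hasOnesRun m w) (sym notHere)) eq)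
...   | i , i+m≤|w| , window≡m = suc i , s≤s i+m≤|w| , window≡m

hasOnesRun≡0⇒F≤ : ∀ j w → hasOnesRun (suc j) w ≡ 0 → F w (suc j) ≤ j
hasOnesRun≡0⇒F≤ j w eq = F-lub w (suc j) (λ i _ → ≤-pred (startsWithOnes≡0⇒P< (suc j) (drop i w)
  (n≤0⇒n≡0 (subst (startsWithOnes (suc j) (drop i w) ≤_) eq (startsWithOnes-drop≤hasOnesRun (suc j) w i)))))

noOnesRun-++ : ∀ m u v → 1 ∸ hasOnesRun m (u ++ v) ≤ (1 ∸ startsWithOnes m u) * (1 ∸ hasOnesRun m v)
noOnesRun-++ m u v = ≤1⇒≤* (m∸n≤m 1 (hasOnesRun m (u ++ v)))
  (∸-monoʳ-≤ 1 (≤-trans (startsWithOnes-++ m u v) (startsWithOnes≤hasOnesRun m (u ++ v))))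
  (∸-monoʳ-≤ 1 (hasOnesRun-++ m u v))

take-length-++ : ∀ (u v : Word) → take (length u) (u ++ v) ≡ u
take-length-++ []      v = refl
take-length-++ (b ∷ u) v = cong (b ∷_) (take-length-++ u v)

drop-length-++ : ∀ (u v : Word) i → drop (length u + i) (u ++ v) ≡ drop i v
drop-length-++ []      v i = refl
drop-length-++ (b ∷ u) v i = drop-length-++ u v i

ones≤F-++ : ∀ u v → ones u ≤ F (u ++ v) (length u)
ones≤F-++ u v = subst (λ x → ones x ≤ F (u ++ v) (length u)) (take-length-++ u v)
  (window≤F (u ++ v) (length u) z≤n)

F≤F-++ : ∀ u v → length u ≤ length v → F v (length u) ≤ F (u ++ v) (length u)
F≤F-++ u v k≤|v| = F-lub v k (λ i i≤ → subst (_≤ F (u ++ v) k)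
  (cong (ones ∘ take k) (drop-length-++ u v i)) (window≤F (u ++ v) k (shift i i≤)))
  where
  k = length u
  shift : ∀ i → i ≤ length v ∸ k → k + i ≤ length (u ++ v) ∸ k
  shift i i≤ = subst (k + i ≤_) (sym (trans (cong (_∸ k) (length-++ u)) (m+n∸m≡n k (length v))))
    (subst (_≤ length v) (+-comm i k) (m≤o∸n⇒m+n≤o i k≤|v| i≤))

𝟙F<-++ : ∀ j u v → length u ≤ length v →
         𝟙[ F (u ++ v) (length u) < j ] ≤ 𝟙[ ones u < j ] * 𝟙[ F v (length u) < j ]
𝟙F<-++ j u v |u|≤|v| =
  ≤1⇒≤* (𝟙<≤1 _ j) (𝟙<-antitone j (ones≤F-++ u v)) (𝟙<-antitone j (F≤F-++ u v |u|≤|v|))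

-- Counting words

startsWithOnes-sum : ∀ m → sumWords m (startsWithOnes m) ≡ 1
startsWithOnes-sum zero    = refl
startsWithOnes-sum (suc m) = startsWithOnes-sum m

notStartsWithOnes-sum : ∀ m → sumWords m (λ u → 1 ∸ startsWithOnes m u) ≡ 2 ^ m ∸ 1
notStartsWithOnes-sum m = begin
  N                                      ≡⟨ m+n∸n≡m N 1 ⟨
  N + 1 ∸ 1                              ≡⟨ cong (λ s → N + s ∸ 1) (startsWithOnes-sum m) ⟨
  N + sumWords m (startsWithOnes m) ∸ 1  ≡⟨ cong (_∸ 1) (sumWords-complement m (startsWithOnes≤1 m)) ⟩
  2 ^ m ∸ 1                              ∎
  where
  open ≡-Reasoning
  N = sumWords m (λ u → 1 ∸ startsWithOnes m u)

startsWithOnes-count : ∀ j n → sumWords n (startsWithOnes j) * 2 ^ j ≤ 2 ^ n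
startsWithOnes-count zero    n       =
  ≤-reflexive (trans (*-identityʳ _) (trans (sumWords-const n 1) (*-identityˡ _)))
startsWithOnes-count (suc j) zero    = z≤n
startsWithOnes-count (suc j) (suc n) = begin
  S * (2 * 2 ^ j)  ≡⟨ x*[y*z]≡y*[x*z] S 2 (2 ^ j) ⟩
  2 * (S * 2 ^ j)  ≤⟨ *-monoʳ-≤ 2 (startsWithOnes-count j n) ⟩
  2 * 2 ^ n        ∎
  where
  open ≤-Reasoning
  S = sumWords n (startsWithOnes j)
  x*[y*z]≡y*[x*z] : ∀ x y z → x * (y * z) ≡ y * (x * z)
  x*[y*z]≡y*[x*z] = solve-∀

hasOnesRun-count : ∀ j n → sumWords n (hasOnesRun j) * 2 ^ j ≤ suc n * 2 ^ n
hasOnesRun-count j zero    = startsWithOnes-count j 0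
hasOnesRun-count j (suc n) = begin
  sumWords (suc n) (hasOnesRun j) * 2 ^ j
    ≤⟨ *-monoˡ-≤ (2 ^ j) (≤-trans (sumWords-mono n (λ w _ →
         +-mono-≤ (hasOnesRun-∷ j false w) (hasOnesRun-∷ j true w))) (≤-reflexive split)) ⟩
  (S + 2 * T) * 2 ^ j
    ≡⟨ trans (*-distribʳ-+ (2 ^ j) S _) (cong (S * 2 ^ j +_) (*-assoc 2 T (2 ^ j))) ⟩
  S * 2 ^ j + 2 * (T * 2 ^ j)
    ≤⟨ +-mono-≤ (startsWithOnes-count j (suc n)) (*-monoʳ-≤ 2 (hasOnesRun-count j n)) ⟩
  2 ^ suc n + 2 * (suc n * 2 ^ n)
    ≡⟨ rearrange₂ n (2 ^ n) ⟩
  suc (suc n) * 2 ^ suc n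
    ∎
  where
  open ≤-Reasoning
  S = sumWords (suc n) (startsWithOnes j)
  T = sumWords n (hasOnesRun j)
  rearrange₁ : ∀ a b r → (a + r) + (b + r) ≡ (a + b) + 2 * r
  rearrange₁ = solve-∀
  rearrange₂ : ∀ n x → 2 * x + 2 * (suc n * x) ≡ suc (suc n) * (2 * x)
  rearrange₂ = solve-∀
  split : sumWords n (λ w → (startsWithOnes j (false ∷ w) + hasOnesRun j w) +
                            (startsWithOnes j (true ∷ w) + hasOnesRun j w)) ≡ S + 2 * T
  split = trans (sumWords-cong n (λ w → rearrange₁ (startsWithOnes j (false ∷ w)) _ _))
                (trans (sumWords-+ n _ _) (cong (S +_) (sumWords-*ˡ n 2 (hasOnesRun j))))

noOnesRun-count : ∀ m q r → sumWords (q * m + r) (λ w → 1 ∸ hasOnesRun m w) ≤ (2 ^ m ∸ 1) ^ q * 2 ^ r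
noOnesRun-count m zero    r = sumWords-≤ r (λ w _ → m∸n≤m 1 (hasOnesRun m w))
noOnesRun-count m (suc q) r = begin
  sumWords (m + q * m + r) noRun                 ≡⟨ cong (λ n → sumWords n noRun) (+-assoc m (q * m) r) ⟩
  sumWords (m + X) noRun                         ≤⟨ sumWords-++-≤ m X (λ u v _ _ → noOnesRun-++ m u v) ⟩
  sumWords m (λ u → 1 ∸ startsWithOnes m u) * sumWords X noRun
                                                 ≡⟨ cong (_* sumWords X noRun) (notStartsWithOnes-sum m) ⟩
  (2 ^ m ∸ 1) * sumWords X noRun                 ≤⟨ *-monoʳ-≤ (2 ^ m ∸ 1) (noOnesRun-count m q r) ⟩
  (2 ^ m ∸ 1) * ((2 ^ m ∸ 1) ^ q * 2 ^ r)        ≡⟨ *-assoc (2 ^ m ∸ 1) _ _ ⟨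
  (2 ^ m ∸ 1) ^ suc q * 2 ^ r                    ∎
  where
  open ≤-Reasoning
  X = q * m + r
  noRun : Word → ℕ
  noRun w = 1 ∸ hasOnesRun m w

b^q*[1+b+q]≤[1+b]^[1+q] : ∀ b q → b ^ q * (suc b + q) ≤ suc b ^ suc q
b^q*[1+b+q]≤[1+b]^[1+q] b zero    =
  ≤-reflexive (trans (*-identityˡ (suc b + 0)) (trans (+-identityʳ (suc b)) (sym (*-identityʳ (suc b)))))
b^q*[1+b+q]≤[1+b]^[1+q] b (suc q) = begin
  b ^ suc q * (suc b + suc q)     ≡⟨ e₁ (b ^ q) b q ⟩
  b ^ q * (b * (b + q + 2))       ≤⟨ *-monoʳ-≤ (b ^ q) (≤-trans (m≤m+n _ (q + 1)) (≤-reflexive (e₂ b q))) ⟩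
  b ^ q * ((suc b + q) * suc b)   ≡⟨ *-assoc (b ^ q) _ _ ⟨
  b ^ q * (suc b + q) * suc b     ≤⟨ *-monoˡ-≤ (suc b) (b^q*[1+b+q]≤[1+b]^[1+q] b q) ⟩
  suc b ^ suc q * suc b           ≡⟨ *-comm (suc b ^ suc q) _ ⟩
  suc b ^ suc (suc q)             ∎
  where
  open ≤-Reasoning
  e₁ : ∀ p b q → (b * p) * (suc b + suc q) ≡ p * (b * (b + q + 2))
  e₁ = solve-∀
  e₂ : ∀ b q → b * (b + q + 2) + (q + 1) ≡ (suc b + q) * suc b
  e₂ = solve-∀

2*b^[1+b]≤[1+b]^[1+b] : ∀ b → 2 * b ^ suc b ≤ suc b ^ suc b
2*b^[1+b]≤[1+b]^[1+b] b = *-cancelˡ-≤ (suc b)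
  (≤-trans (≤-reflexive (rearrange (b ^ suc b) b)) (b^q*[1+b+q]≤[1+b]^[1+q] b (suc b)))
  where
  rearrange : ∀ x b → suc b * (2 * x) ≡ x * (suc b + suc b)
  rearrange = solve-∀

-- (1 − 2^-m)^(2^m) ≤ 1/2, in the form 2 b^(b+1) ≤ (b+1)^(b+1) for b = 2^m − 1.
noOnesRun-half : ∀ m r → 2 * sumWords (2 ^ m * m + r) (λ w → 1 ∸ hasOnesRun m w) ≤ 2 ^ (2 ^ m * m + r)
noOnesRun-half m r = begin
  2 * sumWords (2 ^ m * m + r) (λ w → 1 ∸ hasOnesRun m w)  ≤⟨ *-monoʳ-≤ 2 (noOnesRun-count m (2 ^ m) r) ⟩
  2 * (b ^ 2 ^ m * 2 ^ r)     ≡⟨ cong (λ e → 2 * (b ^ e * 2 ^ r)) 1+b≡2^m ⟨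
  2 * (b ^ suc b * 2 ^ r)     ≡⟨ *-assoc 2 (b ^ suc b) (2 ^ r) ⟨
  2 * b ^ suc b * 2 ^ r       ≤⟨ *-monoˡ-≤ (2 ^ r) (2*b^[1+b]≤[1+b]^[1+b] b) ⟩
  suc b ^ suc b * 2 ^ r       ≡⟨ cong (λ x → x ^ x * 2 ^ r) 1+b≡2^m ⟩
  (2 ^ m) ^ 2 ^ m * 2 ^ r     ≡⟨ cong (_* 2 ^ r) (^-*-assoc 2 m (2 ^ m)) ⟩
  2 ^ (m * 2 ^ m) * 2 ^ r     ≡⟨ cong (λ e → 2 ^ e * 2 ^ r) (*-comm m (2 ^ m)) ⟩
  2 ^ (2 ^ m * m) * 2 ^ r     ≡⟨ ^-distribˡ-+-* 2 (2 ^ m * m) r ⟨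
  2 ^ (2 ^ m * m + r)         ∎
  where
  open ≤-Reasoning
  b = 2 ^ m ∸ 1
  1+b≡2^m : suc b ≡ 2 ^ m
  1+b≡2^m = m+[n∸m]≡n (m^n>0 2 m)

hasOnesRun-likely : ∀ m n → 2 ^ m * m ≤ n → 2 ^ n ≤ 2 * sumWords n (hasOnesRun m)
hasOnesRun-likely m n 2^m*m≤n = +-cancelˡ-≤ (2 ^ n) _ _ (begin
  2 ^ n + 2 ^ n                   ≡⟨ cong (λ x → x + x) (sumWords-complement n (hasOnesRun≤1 m)) ⟨
  (noRun + run) + (noRun + run)   ≡⟨ rearrange noRun run ⟩
  2 * noRun + 2 * run             ≤⟨ +-monoˡ-≤ (2 * run) noRun-half ⟩
  2 ^ n + 2 * run                 ∎)
  where
  open ≤-Reasoning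
  noRun = sumWords n (λ w → 1 ∸ hasOnesRun m w)
  run = sumWords n (hasOnesRun m)
  rearrange : ∀ x y → (x + y) + (x + y) ≡ 2 * x + 2 * y
  rearrange = solve-∀
  noRun-half : 2 * noRun ≤ 2 ^ n
  noRun-half = subst (λ n → 2 * sumWords n (λ w → 1 ∸ hasOnesRun m w) ≤ 2 ^ n) (m+[n∸m]≡n 2^m*m≤n)
                     (noOnesRun-half m (n ∸ 2 ^ m * m))

𝟙ones<-half : ∀ j → 2 * sumWords (j + j) (λ u → 𝟙[ ones u < j ]) ≤ 2 ^ (j + j)
𝟙ones<-half j = begin
  2 * sumWords k low                           ≡⟨ cong (sumWords k low +_) (+-identityʳ _) ⟩
  sumWords k low + sumWords k low              ≡⟨ cong (sumWords k low +_) (sumWords-map-not k low) ⟨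
  sumWords k low + sumWords k (low ∘ map not)  ≡⟨ sumWords-+ k low (low ∘ map not) ⟨
  sumWords k (λ u → low u + low (map not u))   ≤⟨ sumWords-≤ k (λ u |u| →
                                                    𝟙<+𝟙<≤1 _ _ j (trans (ones+ones-map-not u) |u|)) ⟩
  1 * 2 ^ k                                    ≡⟨ *-identityˡ _ ⟩
  2 ^ k                                        ∎
  where
  open ≤-Reasoning
  k = j + j
  low : Word → ℕ
  low u = 𝟙[ ones u < j ]

F<-count : ∀ j q r → j + j ≤ r →
           2 ^ q * sumWords (q * (j + j) + r) (λ w → 𝟙[ F w (j + j) < j ]) ≤ 2 ^ (q * (j + j) + r)
F<-count j zero    r k≤r = begin
  1 * sumWords r (λ w → 𝟙[ F w (j + j) < j ])  ≡⟨ *-identityˡ _ ⟩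
  sumWords r (λ w → 𝟙[ F w (j + j) < j ])      ≤⟨ sumWords-≤ r (λ w _ → 𝟙<≤1 _ j) ⟩
  1 * 2 ^ r                                    ≡⟨ *-identityˡ _ ⟩
  2 ^ r                                        ∎
  where open ≤-Reasoning
F<-count j (suc q) r k≤r = begin
  2 ^ suc q * sumWords (k + q * k + r) B       ≡⟨ cong (λ n → 2 ^ suc q * sumWords n B) (+-assoc k (q * k) r) ⟩
  2 ^ suc q * sumWords (k + X) B               ≤⟨ *-monoʳ-≤ (2 ^ suc q) (sumWords-++-≤ k X blocks) ⟩
  2 ^ suc q * (sumWords k low * sumWords X B)  ≡⟨ rearrange (2 ^ q) (sumWords k low) (sumWords X B) ⟩
  2 * sumWords k low * (2 ^ q * sumWords X B)  ≤⟨ *-mono-≤ (𝟙ones<-half j) (F<-count j q r k≤r) ⟩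
  2 ^ k * 2 ^ X                                ≡⟨ ^-distribˡ-+-* 2 k X ⟨
  2 ^ (k + X)                                  ≡⟨ cong (2 ^_) (+-assoc k (q * k) r) ⟨
  2 ^ (k + q * k + r)                          ∎
  where
  open ≤-Reasoning
  k = j + j
  X = q * k + r
  B : Word → ℕ
  B w = 𝟙[ F w k < j ]
  low : Word → ℕ
  low u = 𝟙[ ones u < j ]
  blocks : ∀ u v → length u ≡ k → length v ≡ X → B (u ++ v) ≤ low u * B v
  blocks u v |u| |v| = subst (λ k′ → 𝟙[ F (u ++ v) k′ < j ] ≤ low u * 𝟙[ F v k′ < j ]) |u|
    (𝟙F<-++ j u v (subst₂ _≤_ (sym |u|) (sym |v|) (≤-trans k≤r (m≤n+m r (q * k)))))
  rearrange : ∀ p h t → (2 * p) * (h * t) ≡ 2 * h * (p * t)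
  rearrange = solve-∀

-- Logarithms

2*⌊n/2⌋≤n : ∀ n → 2 * ⌊ n /2⌋ ≤ n
2*⌊n/2⌋≤n zero          = z≤n
2*⌊n/2⌋≤n (suc zero)    = z≤n
2*⌊n/2⌋≤n (suc (suc n)) = subst (_≤ suc (suc n)) (sym (*-suc 2 ⌊ n /2⌋)) (s≤s (s≤s (2*⌊n/2⌋≤n n)))

n≤1+2*⌊n/2⌋ : ∀ n → n ≤ suc (2 * ⌊ n /2⌋)
n≤1+2*⌊n/2⌋ zero          = z≤n
n≤1+2*⌊n/2⌋ (suc zero)    = s≤s z≤n
n≤1+2*⌊n/2⌋ (suc (suc n)) =
  subst (suc (suc n) ≤_) (cong suc (sym (*-suc 2 ⌊ n /2⌋))) (s≤s (s≤s (n≤1+2*⌊n/2⌋ n)))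

2^⌊log2⌋≤n : ∀ n (rec : Acc _<_ n) → 1 ≤ n → 2 ^ ⌊log2⌋ n rec ≤ n
2^⌊log2⌋≤n (suc zero)    _         _ = s≤s z≤n
2^⌊log2⌋≤n (suc (suc n)) (acc rec) _ = begin
  2 * 2 ^ ⌊log2⌋ (suc ⌊ n /2⌋) _  ≤⟨ *-monoʳ-≤ 2 (2^⌊log2⌋≤n (suc ⌊ n /2⌋) _ (s≤s z≤n)) ⟩
  2 * suc ⌊ n /2⌋                 ≡⟨ *-suc 2 ⌊ n /2⌋ ⟩
  suc (suc (2 * ⌊ n /2⌋))         ≤⟨ s≤s (s≤s (2*⌊n/2⌋≤n n)) ⟩
  suc (suc n)                     ∎
  where open ≤-Reasoning

2^⌊log₂n⌋≤n : ∀ n → 1 ≤ n → 2 ^ ⌊log₂ n ⌋ ≤ n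
2^⌊log₂n⌋≤n n = 2^⌊log2⌋≤n n _

2^m≤n⇒m≤⌊log₂n⌋ : ∀ {m n} → 2 ^ m ≤ n → m ≤ ⌊log₂ n ⌋
2^m≤n⇒m≤⌊log₂n⌋ {m} 2^m≤n = subst (_≤ _) (⌊log₂[2^n]⌋≡n m) (⌊log₂⌋-mono-≤ 2^m≤n)

n<2^[1+⌊log₂n⌋] : ∀ n → n < 2 ^ suc ⌊log₂ n ⌋
n<2^[1+⌊log₂n⌋] n = ≰⇒> (λ 2^[1+L]≤n → 1+n≰n (2^m≤n⇒m≤⌊log₂n⌋ 2^[1+L]≤n))

n<2^n : ∀ n → n < 2 ^ n
n<2^n zero    = s≤s z≤n
n<2^n (suc n) = +-mono-≤ (m^n>0 2 n) (subst (n <_) (sym (+-identityʳ (2 ^ n))) (n<2^n n))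

4*[11+t]²≤2^[10+t] : ∀ t → 4 * (11 + t) * (11 + t) ≤ 2 ^ (10 + t)
4*[11+t]²≤2^[10+t] zero    = m≤m+n 484 540
4*[11+t]²≤2^[10+t] (suc t) = begin
  4 * (12 + t) * (12 + t)                              ≤⟨ m≤m+n _ (4 * (t * t + 20 * t + 98)) ⟩
  4 * (12 + t) * (12 + t) + 4 * (t * t + 20 * t + 98)  ≡⟨ rearrange t ⟩
  2 * (4 * (11 + t) * (11 + t))                        ≤⟨ *-monoʳ-≤ 2 (4*[11+t]²≤2^[10+t] t) ⟩
  2 * 2 ^ (10 + t)                                     ∎
  where
  open ≤-Reasoning
  rearrange : ∀ t → 4 * (12 + t) * (12 + t) + 4 * (t * t + 20 * t + 98) ≡ 2 * (4 * (11 + t) * (11 + t))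
  rearrange = solve-∀

4*[1+L]²≤2^L : ∀ L → 10 ≤ L → 4 * suc L * suc L ≤ 2 ^ L
4*[1+L]²≤2^L L 10≤L =
  subst (λ L → 4 * suc L * suc L ≤ 2 ^ L) (m+[n∸m]≡n 10≤L) (4*[11+t]²≤2^[10+t] (L ∸ 10))

-- The prefix normal form

module _ (pnf : Word → Word) (isPNF : IsPNF pnf) where

  P-pnf≡F : ∀ w k → 1 ≤ k → k ≤ length w → P (pnf w) k ≡ F w k
  P-pnf≡F w k 1≤k k≤|w| with isPNF w
  ... | |v|≡|w| , normal , sameF =
    sym (trans (sameF k k≤|w|) (normal k 1≤k (subst (k ≤_) (sym |v|≡|w|) k≤|w|)))

  crit-pnf≤length : ∀ w → crit (pnf w) ≤ length w
  crit-pnf≤length w = subst (crit (pnf w) ≤_) (proj₁ (isPNF w)) (crit≤length (pnf w))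

  run≤crit-pnf : ∀ m w → 1 ≤ m → m * hasOnesRun m w ≤ crit (pnf w)
  run≤crit-pnf m w 1≤m with n≤1⇒n≡0∨n≡1 (hasOnesRun≤1 m w)
  ... | inj₁ noRun rewrite noRun | *-zeroʳ m = z≤n
  ... | inj₂ run rewrite run | *-identityʳ m with hasOnesRun≡1⇒window m w run
  ... | i , i+m≤|w| , window≡m = ≤-trans (≤P⇒≤leadOnes m (pnf w) m≤P) (m≤m+n (leadOnes (pnf w)) _)
    where
    m≤P : m ≤ P (pnf w) m
    m≤P = subst (m ≤_) (sym (P-pnf≡F w m 1≤m (m+n≤o⇒n≤o i i+m≤|w|)))
                (subst (_≤ F w m) window≡m (window≤F w m (m+n≤o⇒m≤o∸n i i+m≤|w|)))

  crit-pnf< : ∀ j k w → 1 ≤ k → k ≤ length w → suc j ≤ length w →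
              hasOnesRun (suc j) w ≡ 0 → suc j ≤ F w k → crit (pnf w) < k
  crit-pnf< j k w 1≤k k≤|w| j<|w| noRun j<F = ≰⇒> λ k≤crit →
    1+n≰n (≤-trans j<F (≤-trans (≤-reflexive (sym (P-pnf≡F w k 1≤k k≤|w|)))
                                 (≤-trans (P≤leadOnes k (pnf w) k≤crit) leadOnes≤j)))
    where
    leadOnes≤j : leadOnes (pnf w) ≤ j
    leadOnes≤j = ≮⇒≥ λ j<leadOnes → 1+n≰n (subst (_≤ j)
      (trans (sym (P-pnf≡F w (suc j) (s≤s z≤n) j<|w|)) (P-leadOnes (suc j) (pnf w) j<leadOnes))
      (hasOnesRun≡0⇒F≤ j w noRun))

  crit-pnf≤ : ∀ j k w → 1 ≤ k → k ≤ length w → suc j ≤ length w →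
              crit (pnf w) ≤ k + length w * (hasOnesRun (suc j) w + 𝟙[ F w k < suc j ])
  crit-pnf≤ j k w 1≤k k≤|w| j<|w| with hasOnesRun (suc j) w in noRun | 𝟙[ F w k < suc j ] in j≤F
  ... | zero  | zero  = ≤-trans (<⇒≤ (crit-pnf< j k w 1≤k k≤|w| j<|w| noRun (𝟙<≡0⇒≥ _ (suc j) j≤F)))
                                (m≤m+n k _)
  ... | suc _ | _     = ≤-trans (crit-pnf≤length w) (≤-trans (m≤m*n (length w) _) (m≤n+m _ k))
  ... | zero  | suc _ = ≤-trans (crit-pnf≤length w) (≤-trans (m≤m*n (length w) _) (m≤n+m _ k))

  totalZ-lower : ∀ m n → 1 ≤ m → 2 ^ m * m ≤ n → m * 2 ^ n ≤ 2 * totalZ pnf n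
  totalZ-lower m n 1≤m 2^m*m≤n = begin
    m * 2 ^ n                                  ≤⟨ *-monoʳ-≤ m (hasOnesRun-likely m n 2^m*m≤n) ⟩
    m * (2 * sumWords n (hasOnesRun m))        ≡⟨ x*[y*z]≡y*[x*z] m 2 _ ⟩
    2 * (m * sumWords n (hasOnesRun m))        ≡⟨ cong (2 *_) (sumWords-*ˡ n m (hasOnesRun m)) ⟨
    2 * sumWords n (λ w → m * hasOnesRun m w)  ≤⟨ *-monoʳ-≤ 2 (sumWords-mono n (λ w _ → run≤crit-pnf m w 1≤m)) ⟩
    2 * sumWords n (crit ∘ pnf)                ≡⟨ cong (2 *_) (sum-map-allWords n (crit ∘ pnf)) ⟨
    2 * totalZ pnf n                           ∎
    where
    open ≤-Reasoning
    x*[y*z]≡y*[x*z] : ∀ x y z → x * (y * z) ≡ y * (x * z)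
    x*[y*z]≡y*[x*z] = solve-∀

  totalZ-upper : ∀ n L → 10 ≤ L → 2 ^ L ≤ n → n < 2 ^ suc L → totalZ pnf n ≤ 5 * L * 2 ^ n
  totalZ-upper n L 10≤L 2^L≤n n<2^[1+L] = begin
    totalZ pnf n                                       ≡⟨ sum-map-allWords n (crit ∘ pnf) ⟩
    sumWords n (crit ∘ pnf)                            ≤⟨ sumWords-mono n pointwise ⟩
    sumWords n (λ w → k + n * (R w + B w))             ≡⟨ expand ⟩
    k * 2 ^ n + (n * sumWords n R + n * sumWords n B)  ≤⟨ +-monoʳ-≤ (k * 2 ^ n) (+-mono-≤ n*ΣR≤ n*ΣB≤) ⟩
    k * 2 ^ n + (2 ^ n + 2 * 2 ^ n)                    ≡⟨ rearrange k (2 ^ n) ⟩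
    (k + 3) * 2 ^ n                                    ≤⟨ *-monoˡ-≤ (2 ^ n) k+3≤5L ⟩
    5 * L * 2 ^ n                                      ∎
    where
    open ≤-Reasoning
    l = suc L
    j = l + l
    k = j + j
    R : Word → ℕ
    R = hasOnesRun j
    B : Word → ℕ
    B w = 𝟙[ F w k < j ]
    rearrange : ∀ k x → k * x + (x + 2 * x) ≡ (k + 3) * x
    rearrange = solve-∀
    k+3≤5L : k + 3 ≤ 5 * L
    k+3≤5L = subst₂ _≤_ (e₁ L) (e₂ L) (+-monoʳ-≤ (4 * L) (≤-trans (m≤m+n 7 3) 10≤L))
      where
      e₁ : ∀ L → 4 * L + 7 ≡ ((suc L + suc L) + (suc L + suc L)) + 3
      e₁ = solve-∀
      e₂ : ∀ L → 4 * L + L ≡ 5 * L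
      e₂ = solve-∀
    l*k≤n : l * k ≤ n
    l*k≤n = subst (_≤ n) (e L) (≤-trans (4*[1+L]²≤2^L L 10≤L) 2^L≤n)
      where
      e : ∀ L → 4 * suc L * suc L ≡ suc L * ((suc L + suc L) + (suc L + suc L))
      e = solve-∀
    k≤n : k ≤ n
    k≤n = ≤-trans (m≤n*m k l) l*k≤n
    pointwise : ∀ w → length w ≡ n → crit (pnf w) ≤ k + n * (R w + B w)
    pointwise w |w| = subst (λ n → crit (pnf w) ≤ k + n * (R w + B w)) |w|
      (crit-pnf≤ (L + l) k w (s≤s z≤n) (subst (k ≤_) (sym |w|) k≤n)
                 (subst (j ≤_) (sym |w|) (≤-trans (m≤m+n j j) k≤n)))
    expand : sumWords n (λ w → k + n * (R w + B w)) ≡ k * 2 ^ n + (n * sumWords n R + n * sumWords n B)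
    expand = trans (sumWords-+ n (λ _ → k) _) (cong₂ _+_ (sumWords-const n k)
      (trans (sumWords-*ˡ n n _) (trans (cong (n *_) (sumWords-+ n R B)) (*-distribˡ-+ n _ _))))
    n*ΣR≤ : n * sumWords n R ≤ 2 ^ n
    n*ΣR≤ = *-cancelˡ-≤ (2 ^ j) {{m^n≢0 2 j}} (begin
      2 ^ j * (n * sumWords n R)  ≡⟨ x*[y*z]≡y*[z*x] (2 ^ j) n (sumWords n R) ⟩
      n * (sumWords n R * 2 ^ j)  ≤⟨ *-monoʳ-≤ n (hasOnesRun-count j n) ⟩
      n * (suc n * 2 ^ n)         ≡⟨ *-assoc n (suc n) (2 ^ n) ⟨
      n * suc n * 2 ^ n           ≤⟨ *-monoˡ-≤ (2 ^ n) (*-mono-≤ (<⇒≤ n<2^[1+L]) n<2^[1+L]) ⟩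
      2 ^ l * 2 ^ l * 2 ^ n       ≡⟨ cong (_* 2 ^ n) (^-distribˡ-+-* 2 l l) ⟨
      2 ^ j * 2 ^ n               ∎)
      where
      x*[y*z]≡y*[z*x] : ∀ x y z → x * (y * z) ≡ y * (z * x)
      x*[y*z]≡y*[z*x] = solve-∀
    n*ΣB≤ : n * sumWords n B ≤ 2 * 2 ^ n
    n*ΣB≤ = begin
      n * sumWords n B            ≤⟨ *-monoˡ-≤ (sumWords n B) (<⇒≤ n<2^[1+L]) ⟩
      2 * 2 ^ L * sumWords n B    ≡⟨ *-assoc 2 (2 ^ L) _ ⟩
      2 * (2 ^ L * sumWords n B)  ≤⟨ *-monoʳ-≤ 2 L-blocks ⟩
      2 * 2 ^ n                   ∎
      where
      L-blocks : 2 ^ L * sumWords n B ≤ 2 ^ n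
      L-blocks = subst (λ n → 2 ^ L * sumWords n B ≤ 2 ^ n) (m+[n∸m]≡n (m+n≤o⇒n≤o k l*k≤n))
                       (F<-count j L (n ∸ L * k) (m+n≤o⇒m≤o∸n k l*k≤n))

  totalZ-lower-log : ∀ n → 4 ≤ n → ⌊log₂ n ⌋ * 2 ^ n ≤ 6 * totalZ pnf n
  totalZ-lower-log n 4≤n = begin
    L * 2 ^ n               ≤⟨ *-monoˡ-≤ (2 ^ n) (≤-trans (n≤1+2*⌊n/2⌋ L) (+-monoˡ-≤ (2 * m) 1≤m)) ⟩
    3 * m * 2 ^ n           ≡⟨ *-assoc 3 m (2 ^ n) ⟩
    3 * (m * 2 ^ n)         ≤⟨ *-monoʳ-≤ 3 (totalZ-lower m n 1≤m 2^m*m≤n) ⟩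
    3 * (2 * totalZ pnf n)  ≡⟨ *-assoc 3 2 (totalZ pnf n) ⟨
    6 * totalZ pnf n        ∎
    where
    open ≤-Reasoning
    L = ⌊log₂ n ⌋
    m = ⌊ L /2⌋
    1≤m : 1 ≤ m
    1≤m = ⌊n/2⌋-mono (2^m≤n⇒m≤⌊log₂n⌋ {2} 4≤n)
    2^m*m≤n : 2 ^ m * m ≤ n
    2^m*m≤n = begin
      2 ^ m * m      ≤⟨ *-monoʳ-≤ (2 ^ m) (<⇒≤ (n<2^n m)) ⟩
      2 ^ m * 2 ^ m  ≡⟨ ^-distribˡ-+-* 2 m m ⟨
      2 ^ (m + m)    ≤⟨ ^-monoʳ-≤ 2 (subst (_≤ L) (cong (m +_) (+-identityʳ m)) (2*⌊n/2⌋≤n L)) ⟩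
      2 ^ L          ≤⟨ 2^⌊log₂n⌋≤n n (≤-trans (s≤s z≤n) 4≤n) ⟩
      n              ∎

  totalZ-upper-log : ∀ n → 1024 ≤ n → totalZ pnf n ≤ 5 * ⌊log₂ n ⌋ * 2 ^ n
  totalZ-upper-log n 1024≤n = totalZ-upper n ⌊log₂ n ⌋ (2^m≤n⇒m≤⌊log₂n⌋ {10} 1024≤n)
    (2^⌊log₂n⌋≤n n (≤-trans (s≤s z≤n) 1024≤n)) (n<2^[1+⌊log₂n⌋] n)

lemma5 : (pnf : Word → Word) → IsPNF pnf →
    (∃ λ a → ∃ λ b → ∃ λ N → 0 < a ×
        (∀ n → N ≤ n → a * ⌊log₂ n ⌋ * 2 ^ n ≤ b * totalZ pnf n))
    × (∃ λ C → ∃ λ N →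
        (∀ n → N ≤ n → totalZ pnf n ≤ C * ⌊log₂ n ⌋ * 2 ^ n))
lemma5 pnf isPNF =
  (1 , 6 , 4 , s≤s z≤n , λ n 4≤n →
     subst (λ x → x * 2 ^ n ≤ 6 * totalZ pnf n) (sym (*-identityˡ ⌊log₂ n ⌋)) (totalZ-lower-log pnf isPNF n 4≤n)) ,
  (5 , 1024 , totalZ-upper-log pnf isPNF)
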